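{- For all integers $n\ge 4$ and $k$ with $\frac{n}{2}\ge k\ge 2$, there exists a feasible simple homogeneous PV graph $\vec G_R$ with $n$ sites and $k$ carriers such that $$\mathcal M(\vec G_R)>\tfrac18\,k\,n\,(n-8).$$ This holds even if the agent knows $\vec G_R$ and $k$ and has unlimited memory.
   Context: A PV system consists of a finite set $S$ of $n$ sites and a set $C$ of $k\le n$ carriers; each carrier $c$ has a unique identifier and a route $\pi(c)=\langle x_0,\dots,x_{p(c)-1}\rangle$ of sites, with period $p(c)$ and $\pi(c)[j]=x_{j\bmod p(c)}$; at each time $t=0,1,\dots$ carrier $c$ moves from $\pi(c)[t]$ to $\pi(c)[t+1]$. The PV graph $\vec G_R$ is the directed edge-labelled multigraph on $S$ with edges $\bigcup_c\{(x_i,x_{i+1},i)\}$ (indices mod $p(c)$). It is homogeneous if all periods are equal. A route is simple if its directed multigraph $\{(x_i,x_{i+1},i)\}$ has no self-loops and no multiple edges, i.e. $x_i\neq x_{i+1}$ for all $i$, and $(x_i,x_{i+1})=(x_j,x_{j+1})$ implies $i=j$ (indices mod $p(c)$); the PV graph is simple if every route is simple. An exploring agent is placed at time $0$ at a starting site $x\in\{\pi(c)[0]:c\in C\}$; at each time $t$, being at site $y$, it either halts or chooses a carrier $c$ with $\pi(c)[t]=y$ and moves with it to $\pi(c)[t+1]$ (one move). $\vec G_R$ is feasible if from every starting site there is a finite sequence of such moves visiting all sites. $\mathcal M(\vec G_R)$ is the minimum, over all agent strategies (which may use complete knowledge of $\vec G_R$ and unlimited memory) that from every starting site visit all sites and halt,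 of the maximum over starting sites of the number of moves made. -}

module Defs where

open import Data.Nat using (ℕ; zero; suc; _+_; _*_)
open import Data.Nat.DivMod using (_mod_)
open import Data.Fin using (Fin; toℕ)
open import Data.Product using (Σ; ∃; _×_; _,_)
open import Data.Integer as ℤ using (ℤ; +_)
open import Relation.Binary.PropositionalEquality using (_≡_; _≢_)

-- A homogeneous PV system with n sites (Fin n) and k carriers (Fin k).
-- All routes share the common period  p = suc pred-period  (periods are positive).
-- route c j  is  x_j  for j = 0 .. p-1.
record HomPV (n k : ℕ) : Set where
  field
    pred-period : ℕ
    route       : Fin k → Fin (suc pred-period) → Fin n

  period : ℕ
  period = suc pred-period

  at : Fin k → ℕ → Fin n
  at c t = route c (t mod period)

open HomPV public

SimpleRoute : ∀ {n k} → HomPV n k → Fin k → Set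
SimpleRoute G c =
  (∀ (i : Fin (period G)) → at G c (toℕ i) ≢ at G c (suc (toℕ i)))
  × (∀ (i j : Fin (period G)) →
       at G c (toℕ i) ≡ at G c (toℕ j) →
       at G c (suc (toℕ i)) ≡ at G c (suc (toℕ j)) → i ≡ j)

Simple : ∀ {n k} → HomPV n k → Set
Simple {k = k} G = ∀ (c : Fin k) → SimpleRoute G c

IsStart : ∀ {n k} → HomPV n k → Fin n → Set
IsStart {k = k} G x = ∃ λ (c : Fin k) → at G c 0 ≡ x

data Run {n k : ℕ} (G : HomPV n k) : ℕ → Fin n → Set where
  halt : ∀ {t y} → Run G t y
  move : ∀ {t y} (c : Fin k) → at G c t ≡ y →
         Run G (suc t) (at G c (suc t)) → Run G t y

moves : ∀ {n k} {G : HomPV n k} {t y} → Run G t y → ℕ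
moves halt         = zero
moves (move _ _ r) = suc (moves r)

data Visits {n k : ℕ} {G : HomPV n k} (s : Fin n) : ∀ {t y} → Run G t y → Set where
  here  : ∀ {t} {r : Run G t s} → Visits s r
  there : ∀ {t y c} {e : at G c t ≡ y} {r : Run G (suc t) (at G c (suc t))} →
          Visits s r → Visits s (move c e r)

Explores : ∀ {n k} {G : HomPV n k} {t y} → Run G t y → Set
Explores {n = n} r = ∀ (s : Fin n) → Visits s r

Feasible : ∀ {n k} → HomPV n k → Set
Feasible {n = n} G = ∀ (x : Fin n) → IsStart G x → Σ (Run G 0 x) Explores

-- An exploration strategy (full knowledge of G, unlimited memory): for every
-- starting site, a finite run from time 0 visiting all sites, then halting.
Strategy : ∀ {n k} → HomPV n k → Set
Strategy = Feasible

-- 𝓜(G) > B : every exploring strategy makes more than B moves from some start,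
-- i.e. min over strategies of max over starting sites of #moves exceeds B.
MExceeds : ∀ {n k} → HomPV n k → (ℕ → Set) → Set
MExceeds {n = n} G Big =
  ∀ (σ : Strategy G) → ∃ λ (x : Fin n) → Σ (IsStart G x) λ st →
    Big (moves (Data.Product.proj₁ (σ x st)))

-- For n < 8 the bound is negative and a cycle ridden by all carriers is a witness.
-- For n ≥ 8 take m = n − k ≥ k ordinary sites, k gates  m, …, m + k − 1,  and h = ⌊m/2⌋ ≥ 2.
-- The ordinary sites carry a closed simple tour of the complete bipartite digraph K(h,h)
-- of length p = 2h² (BipartiteTour).  Carrier c follows this tour shifted by c modulo m,
-- except that at phase P − c (where P = p − 1) it sits on gate c and at the next phase on
-- gate c − 1 (Construction).  Hence carriers meet only in the pairs c, c + 1 at gate c,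
-- and an invariant on runs (Late) shows that from the start of carrier 0 the last gate,
-- hence a complete exploration, costs at least kP moves.  Conversely, from any start the
-- agent rides to its gate, descends gate by gate to carrier 0, rides it once round the
-- tour and climbs back to the last gate, visiting every site (Exploration).  Since
-- n ≤ 4h + 2, finally  k n (n − 8) < 8kP.
module Submission where

open import Data.Nat
open import Data.Nat.Properties
open import Data.Nat.DivMod
open import Data.Nat.Tactic.RingSolver using (solve-∀)
open import Data.Fin as Fin using (Fin; toℕ; fromℕ<)
open import Data.Fin.Properties using (toℕ-fromℕ<; fromℕ<-toℕ; toℕ-injective; toℕ<n)
open import Data.Product using (Σ; _×_; _,_; proj₁; proj₂)
open import Data.Sum using (_⊎_; inj₁; inj₂)
open import Data.Empty using (⊥-elim)
open import Relation.Nullary using (yes; no; ¬_)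
open import Relation.Binary using (tri<; tri≈; tri>)
open import Relation.Binary.PropositionalEquality
open import Data.Integer as ℤ using (+_; -<+; +<+)
import Data.Integer.Properties as ℤ
open import Defs

%-absorbˡ : ∀ x c d .{{_ : NonZero d}} → (x % d + c) % d ≡ (x + c) % d
%-absorbˡ x c d = begin
  (x % d + c) % d          ≡⟨ %-distribˡ-+ (x % d) c d ⟩
  (x % d % d + c % d) % d  ≡⟨ cong (λ u → (u + c % d) % d) (m%n%n≡m%n x d) ⟩
  (x % d + c % d) % d      ≡⟨ %-distribˡ-+ x c d ⟨
  (x + c) % d              ∎
  where open ≡-Reasoning

%-untranslate : ∀ a b d .{{_ : NonZero d}} → b < d → ((a + b) % d + (d ∸ a % d)) % d ≡ b
%-untranslate a b d b<d = begin
  ((a + b) % d + (d ∸ a % d)) % d  ≡⟨ %-absorbˡ (a + b) (d ∸ a % d) d ⟩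
  (a + b + (d ∸ a % d)) % d        ≡⟨ cong (_% d) sum-eq ⟩
  (b + suc (a / d) * d) % d        ≡⟨ [m+kn]%n≡m%n b (suc (a / d)) d ⟩
  b % d                            ≡⟨ m<n⇒m%n≡m b<d ⟩
  b                                ∎
  where
  open ≡-Reasoning
  regroup : ∀ r q d b s → r + q * d + b + s ≡ b + q * d + (r + s)
  regroup = solve-∀
  sum-eq : a + b + (d ∸ a % d) ≡ b + suc (a / d) * d
  sum-eq = begin
    a + b + (d ∸ a % d)                       ≡⟨ cong (λ u → u + b + (d ∸ a % d)) (m≡m%n+[m/n]*n a d) ⟩
    a % d + a / d * d + b + (d ∸ a % d)       ≡⟨ regroup (a % d) (a / d) d b (d ∸ a % d) ⟩
    b + a / d * d + (a % d + (d ∸ a % d))     ≡⟨ cong (λ u → b + a / d * d + u) (m+[n∸m]≡n (m%n≤n a d)) ⟩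
    b + a / d * d + d                         ≡⟨ +-assoc b (a / d * d) d ⟩
    b + (a / d * d + d)                       ≡⟨ cong (λ u → b + u) (+-comm (a / d * d) d) ⟩
    b + suc (a / d) * d                       ∎

%-translate-injective : ∀ a {b b'} d .{{_ : NonZero d}} → b < d → b' < d →
                        (a + b) % d ≡ (a + b') % d → b ≡ b'
%-translate-injective a {b} {b'} d b<d b'<d eq = begin
  b                                 ≡⟨ %-untranslate a b d b<d ⟨
  ((a + b) % d + (d ∸ a % d)) % d   ≡⟨ cong (λ u → (u + (d ∸ a % d)) % d) eq ⟩
  ((a + b') % d + (d ∸ a % d)) % d  ≡⟨ %-untranslate a b' d b'<d ⟩
  b'                                ∎
  where open ≡-Reasoning

%-step : ∀ P t → t % suc P < P → suc t % suc P ≡ suc (t % suc P)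
%-step P t τ<P = begin
  suc t % suc P            ≡⟨ cong (_% suc P) (+-comm 1 t) ⟩
  (t + 1) % suc P          ≡⟨ %-absorbˡ t 1 (suc P) ⟨
  (t % suc P + 1) % suc P  ≡⟨ cong (_% suc P) (+-comm (t % suc P) 1) ⟩
  suc (t % suc P) % suc P  ≡⟨ m<n⇒m%n≡m (s≤s τ<P) ⟩
  suc (t % suc P)          ∎
  where open ≡-Reasoning

%-step-back : ∀ P t τ → t % suc P ≡ suc τ → (P + t) % suc P ≡ τ
%-step-back P t τ t≡τ+1 = begin
  (P + t) % suc P          ≡⟨ cong (_% suc P) (+-comm P t) ⟩
  (t + P) % suc P          ≡⟨ %-absorbˡ t P (suc P) ⟨
  (t % suc P + P) % suc P  ≡⟨ cong (λ u → (u + P) % suc P) t≡τ+1 ⟩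
  (suc τ + P) % suc P      ≡⟨ cong (_% suc P) (sym (+-suc τ P)) ⟩
  (τ + suc P) % suc P      ≡⟨ [m+n]%n≡m%n τ (suc P) ⟩
  τ % suc P                ≡⟨ m<n⇒m%n≡m (<-trans (n<1+n τ) τ+1<p) ⟩
  τ                        ∎
  where
  open ≡-Reasoning
  τ+1<p : suc τ < suc P
  τ+1<p = subst (_< suc P) t≡τ+1 (m%n<n t (suc P))

%-step-moves : ∀ P τ → P ≢ 0 → τ ≤ P → suc τ % suc P ≢ τ
%-step-moves P τ P≢0 τ≤P with m≤n⇒m<n∨m≡n τ≤P
... | inj₁ τ<P = λ eq → 1+n≢n (trans (sym (m<n⇒m%n≡m (s≤s τ<P))) eq)
... | inj₂ refl = λ eq → P≢0 (trans (sym eq) (n%n≡0 (suc P)))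

late-phase : ∀ P c t → c * P ≤ t → suc t % suc P + c ≡ P → suc c * P ≤ suc t
late-phase P c t cP≤t at-phase with c ≤? suc t / suc P
... | yes c≤q = begin
    suc c * P          ≡⟨⟩
    P + c * P          ≡⟨ cong (_+ c * P) (sym at-phase) ⟩
    r + c + c * P      ≡⟨ +-assoc r c (c * P) ⟩
    r + (c + c * P)    ≡⟨ cong (λ u → r + u) (*-suc c P) ⟨
    r + c * suc P      ≤⟨ +-monoʳ-≤ r (*-monoˡ-≤ (suc P) c≤q) ⟩
    r + q * suc P      ≡⟨ m≡m%n+[m/n]*n (suc t) (suc P) ⟨
    suc t              ∎
  where
  open ≤-Reasoning
  r = suc t % suc P
  q = suc t / suc P
... | no c≰q = ⊥-elim (<-irrefl refl (begin-strict
    suc t              ≡⟨ m≡m%n+[m/n]*n (suc t) (suc P) ⟩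
    r + q * suc P      ≡⟨ cong (λ u → r + u) (*-suc q P) ⟩
    r + (q + q * P)    ≡⟨ +-assoc r q (q * P) ⟨
    r + q + q * P      <⟨ +-monoˡ-< (q * P) (+-monoʳ-< r q<c) ⟩
    r + c + q * P      ≡⟨ cong (_+ q * P) at-phase ⟩
    suc q * P          ≤⟨ *-monoˡ-≤ P q<c ⟩
    c * P              ≤⟨ cP≤t ⟩
    t                  <⟨ n<1+n t ⟩
    suc t              ∎))
  where
  open ≤-Reasoning
  r = suc t % suc P
  q = suc t / suc P
  q<c : q < c
  q<c = ≰⇒> c≰q

module Runs {n k : ℕ} (G : HomPV n k) where
  ride : (c : Fin k) (d t T : ℕ) → d + t ≡ T → Run G T (at G c T) → Run G t (at G c t)
  ride c zero    t T refl r = r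
  ride c (suc d) t T eq   r = move c refl (ride c d (suc t) T (trans (+-suc d t) eq) r)

  ride-keeps : ∀ {s} c d t T eq r → Visits s r → Visits s (ride c d t T eq r)
  ride-keeps c zero    t T refl r v = v
  ride-keeps c (suc d) t T eq   r v = there (ride-keeps c d (suc t) T (trans (+-suc d t) eq) r v)

  ride-visits : ∀ c d t T eq r i → i ≤ d → Visits (at G c (i + t)) (ride c d t T eq r)
  ride-visits c d       t T eq r zero    _         = here
  ride-visits c (suc d) t T eq r (suc i) (s≤s i≤d) =
    there (subst (λ u → Visits (at G c u) rest) (+-suc i t) (ride-visits c d (suc t) T eq' r i i≤d))
    where
    eq' = trans (+-suc d t) eq
    rest = ride c d (suc t) T eq' r

  transfer : ∀ {t y y'} → y ≡ y' → Run G t y → Run G t y'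
  transfer refl r = r

  transfer-keeps : ∀ {s t y y'} (e : y ≡ y') (r : Run G t y) → Visits s r → Visits s (transfer e r)
  transfer-keeps refl r v = v

-- A closed tour of the complete bipartite digraph with left vertices 0 … h − 1 and right
-- vertices h … 2h − 1.  Round q walks  x → h + (x + q) % h → x + 1  for x = 0 … h − 1; over
-- the h rounds every edge in either direction is used exactly once, so the tour, of length
-- p = 2h², is simple.
module BipartiteTour (h₁ : ℕ) where
  h : ℕ
  h = suc h₁

  data Side : Set where
    left right : Side

  record TourState : Set where
    constructor state
    field
      round col : ℕ
      side      : Side

  Valid : TourState → Set
  Valid (state q x _) = q < h × x < h

  next : TourState → TourState
  next (state q x left) = state q x right
  next (state q x right) with suc x <? h
  ... | yes _ = state q (suc x) left
  ... | no _ with suc q <? h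
  ...   | yes _ = state (suc q) 0 left
  ...   | no _ = state 0 0 left

  stateAt : ℕ → TourState
  stateAt zero    = state 0 0 left
  stateAt (suc τ) = next (stateAt τ)

  bit : Side → ℕ
  bit left  = 0
  bit right = 1

  index : TourState → ℕ
  index (state q x s) = 2 * (q * h + x) + bit s

  -- P is the index of the last state  state h₁ h₁ right;  p = 2h² is the length.
  P : ℕ
  P = 2 * (h₁ * h + h₁) + 1

  p : ℕ
  p = suc P

  vertex : TourState → ℕ
  vertex (state q x left)  = x
  vertex (state q x right) = h + (x + q) % h

  next-valid : ∀ s → Valid s → Valid (next s)
  next-valid (state q x left) v = v
  next-valid (state q x right) (q<h , x<h) with suc x <? h
  ... | yes x+1<h = q<h , x+1<h
  ... | no _ with suc q <? h
  ...   | yes q+1<h = q+1<h , s≤s z≤n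
  ...   | no _ = s≤s z≤n , s≤s z≤n

  stateAt-valid : ∀ τ → Valid (stateAt τ)
  stateAt-valid zero    = s≤s z≤n , s≤s z≤n
  stateAt-valid (suc τ) = next-valid (stateAt τ) (stateAt-valid τ)

  last-one : ∀ {x} → x < h → ¬ (suc x < h) → x ≡ h₁
  last-one x<h x+1≮h = ≤-antisym (≤-pred x<h) (≤-pred (≮⇒≥ x+1≮h))

  index-≤P : ∀ s → Valid s → index s ≤ P
  index-≤P (state q x s) (q<h , x<h) =
    +-mono-≤ (*-monoʳ-≤ 2 (+-mono-≤ (*-monoˡ-≤ h (≤-pred q<h)) (≤-pred x<h))) (bit≤1 s)
    where
    bit≤1 : ∀ s → bit s ≤ 1
    bit≤1 left  = z≤n
    bit≤1 right = s≤s z≤n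

  next-index : ∀ s → Valid s →
               index (next s) ≡ suc (index s) ⊎ (index s ≡ P × next s ≡ state 0 0 left)
  next-index (state q x left) _ = inj₁ (to-right (q * h + x))
    where
    to-right : ∀ a → 2 * a + 1 ≡ suc (2 * a + 0)
    to-right = solve-∀
  next-index (state q x right) (q<h , x<h) with suc x <? h
  ... | yes _ = inj₁ (next-col h₁ q x)
    where
    next-col : ∀ h₁ q x → 2 * (q * suc h₁ + suc x) + 0 ≡ suc (2 * (q * suc h₁ + x) + 1)
    next-col = solve-∀
  ... | no x+1≮h with suc q <? h
  ...   | yes _ rewrite last-one x<h x+1≮h = inj₁ (next-round h₁ q)
    where
    next-round : ∀ h₁ q → 2 * (suc q * suc h₁ + 0) + 0 ≡ suc (2 * (q * suc h₁ + h₁) + 1)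
    next-round = solve-∀
  ...   | no q+1≮h rewrite last-one x<h x+1≮h | last-one q<h q+1≮h = inj₂ (refl , refl)

  index-stateAt : ∀ τ → τ ≤ P → index (stateAt τ) ≡ τ
  index-stateAt zero    _       = refl
  index-stateAt (suc τ) τ+1≤P with next-index (stateAt τ) (stateAt-valid τ)
  ... | inj₁ advance     = trans advance (cong suc previous)
    where previous = index-stateAt τ (≤-trans (n≤1+n τ) τ+1≤P)
  ... | inj₂ (at-last , _) = ⊥-elim (<-irrefl (trans (sym previous) at-last) τ+1≤P)
    where previous = index-stateAt τ (≤-trans (n≤1+n τ) τ+1≤P)

  stateAt-injective : ∀ {i j} → i ≤ P → j ≤ P → stateAt i ≡ stateAt j → i ≡ j
  stateAt-injective {i} {j} i≤P j≤P eq =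
    trans (sym (index-stateAt i i≤P)) (trans (cong index eq) (index-stateAt j j≤P))

  tick : ℕ → ℕ
  tick τ = suc τ % p

  P≢0 : P ≢ 0
  P≢0 P≡0 = 1+n≢0 (trans (+-comm 1 _) P≡0)

  tick-injective : ∀ {i j} → i ≤ P → j ≤ P → tick i ≡ tick j → i ≡ j
  tick-injective i≤P j≤P = %-translate-injective 1 p (s≤s i≤P) (s≤s j≤P)

  stateAt-tick : ∀ τ → τ ≤ P → stateAt (tick τ) ≡ next (stateAt τ)
  stateAt-tick τ τ≤P with m≤n⇒m<n∨m≡n τ≤P
  ... | inj₁ τ<P = cong stateAt (m<n⇒m%n≡m (s≤s τ<P))
  ... | inj₂ refl with next-index (stateAt P) (stateAt-valid P)
  ...   | inj₁ advance = ⊥-elim (1+n≰n (subst (_≤ P) past-end (index-≤P (stateAt p) (stateAt-valid p))))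
    where
    past-end : index (stateAt p) ≡ suc P
    past-end = trans advance (cong suc (index-stateAt P ≤-refl))
  ...   | inj₂ (_ , wraps) = trans (cong stateAt (n%n≡0 p)) (sym wraps)

  vertex-<2h : ∀ s → Valid s → vertex s < h + h
  vertex-<2h (state q x left)  (_ , x<h) = ≤-trans x<h (m≤m+n h h)
  vertex-<2h (state q x right) _         = +-monoʳ-< h (m%n<n (x + q) h)

  vertex-after-right : ∀ q x → x < h → vertex (next (state q x right)) ≡ suc x % h
  vertex-after-right q x x<h with suc x <? h
  ... | yes x+1<h = sym (m<n⇒m%n≡m x+1<h)
  ... | no x+1≮h with suc q <? h
  ...   | yes _ rewrite last-one x<h x+1≮h = sym (n%n≡0 h)
  ...   | no _  rewrite last-one x<h x+1≮h = sym (n%n≡0 h)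

  -- The tour never stays put: it alternates between the two sides.
  vertex-no-loop : ∀ s → Valid s → vertex s ≢ vertex (next s)
  vertex-no-loop (state q x left)  (_ , x<h) eq = <⇒≱ (subst (_< h) eq x<h) (m≤m+n h _)
  vertex-no-loop (state q x right) (_ , x<h) eq =
    <⇒≱ (subst (_< h) (trans (sym (vertex-after-right q x x<h)) (sym eq)) (m%n<n (suc x) h)) (m≤m+n h _)

  vertex-edge-injective : ∀ s s' → Valid s → Valid s' →
    vertex s ≡ vertex s' → vertex (next s) ≡ vertex (next s') → s ≡ s'
  vertex-edge-injective (state q x left) (state q' x' left) (q<h , _) (q'<h , _) refl out =
    cong (λ r → state r x left) (%-translate-injective x h q<h q'<h (+-cancelˡ-≡ h _ _ out))
  vertex-edge-injective (state q x left) (state q' x' right) (_ , x<h) _ at _ =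
    ⊥-elim (<⇒≱ (subst (_< h) at x<h) (m≤m+n h _))
  vertex-edge-injective (state q x right) (state q' x' left) _ (_ , x'<h) at _ =
    ⊥-elim (<⇒≱ (subst (_< h) (sym at) x'<h) (m≤m+n h _))
  vertex-edge-injective (state q x right) (state q' x' right) (q<h , x<h) (q'<h , x'<h) at out =
    cong₂ (λ r c → state r c right) same-round same-col
    where
    same-col : x ≡ x'
    same-col = %-translate-injective 1 h x<h x'<h
      (trans (sym (vertex-after-right q x x<h)) (trans out (vertex-after-right q' x' x'<h)))
    same-round : q ≡ q'
    same-round = %-translate-injective x h q<h q'<h
      (trans (+-cancelˡ-≡ h _ _ at) (cong (λ c → (c + q') % h) (sym same-col)))

  stateAt-round0 : ∀ x → x < h → stateAt (2 * x) ≡ state 0 x left × stateAt (suc (2 * x)) ≡ state 0 x right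
  stateAt-round0 zero    _ = refl , refl
  stateAt-round0 (suc x) x+1<h = at-left , cong next at-left
    where
    previous = stateAt-round0 x (≤-trans (n≤1+n _) x+1<h)
    at-left : stateAt (2 * suc x) ≡ state 0 (suc x) left
    at-left rewrite +-suc x (x + 0) | proj₂ previous with suc x <? h
    ... | yes _ = refl
    ... | no x+1≮h = ⊥-elim (x+1≮h x+1<h)

  round0-covers : ∀ y → y < h + h → Σ ℕ λ τ → τ < h + h × vertex (stateAt τ) ≡ y
  round0-covers y y<2h with y <? h
  ... | yes y<h = 2 * y , 2y<2h , cong vertex (proj₁ (stateAt-round0 y y<h))
    where
    2y<2h : 2 * y < h + h
    2y<2h = subst (_< h + h) (cong (λ u → y + u) (sym (+-identityʳ y))) (+-mono-< y<h y<h)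
  ... | no y≮h = suc (2 * x) , 2x+1<2h , trans (cong vertex (proj₂ (stateAt-round0 x x<h))) right-vertex
    where
    x = y ∸ h
    y≡h+x : y ≡ h + x
    y≡h+x = sym (m+[n∸m]≡n (≮⇒≥ y≮h))
    x<h : x < h
    x<h = +-cancelˡ-< h x h (subst (_< h + h) y≡h+x y<2h)
    2x+1<2h : suc (2 * x) < h + h
    2x+1<2h = subst (_≤ h + h) (double-suc x) (+-mono-≤ x<h x<h)
      where
      double-suc : ∀ x → suc x + suc x ≡ suc (suc (2 * x))
      double-suc = solve-∀
    right-vertex : h + (x + 0) % h ≡ y
    right-vertex = trans (cong (λ u → h + u % h) (+-identityʳ x))
                         (trans (cong (λ u → h + u) (m<n⇒m%n≡m x<h)) (sym y≡h+x))

  round0-last : vertex (stateAt (suc (2 * h₁))) ≡ h + h₁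
  round0-last = begin
    vertex (stateAt (suc (2 * h₁)))  ≡⟨ cong vertex (proj₂ (stateAt-round0 h₁ (n<1+n h₁))) ⟩
    h + (h₁ + 0) % h                 ≡⟨ cong (λ x → h + x % h) (+-identityʳ h₁) ⟩
    h + h₁ % h                       ≡⟨ cong (λ x → h + x) (m<n⇒m%n≡m (n<1+n h₁)) ⟩
    h + h₁                           ∎
    where open ≡-Reasoning

-- The PV graph for h = h₁ + 1 ≥ 2, m = m₁ + 1 ∈ {2h, 2h + 1} ordinary sites 0 … m − 1 and
-- k = k₁ + 1 ∈ [2, m] carriers, with gates  m + j  for j < k (so n = m + k sites).
module Construction (h₁ k₁ m₁ : ℕ)
  (2h≤m : suc h₁ + suc h₁ ≤ suc m₁) (m≤2h+1 : suc m₁ ≤ suc (suc h₁ + suc h₁))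
  (k≤m : suc k₁ ≤ suc m₁) (1≤h₁ : 1 ≤ h₁) (1≤k₁ : 1 ≤ k₁) where
  open BipartiteTour h₁ public

  m k n : ℕ
  m = suc m₁
  k = suc k₁
  n = m + k

  shifted : ℕ → ℕ → ℕ
  shifted c τ = (vertex (stateAt τ) + c) % m

  site : ℕ → ℕ → ℕ
  site c τ with τ + c ≟ P
  ... | yes _ = m + c
  site zero    τ | no _ = shifted 0 τ
  site (suc c) τ | no _ with τ + c ≟ P
  ...   | yes _ = m + c
  ...   | no _  = shifted (suc c) τ

  data SiteView (c τ : ℕ) : ℕ → Set where
    own-gate  : τ + c ≡ P → SiteView c τ (m + c)
    prev-gate : ∀ {c'} → c ≡ suc c' → τ + c' ≡ P → SiteView c τ (m + c')
    ordinary  : τ + c ≢ P → (∀ {c'} → c ≡ suc c' → τ + c' ≢ P) → SiteView c τ (shifted c τ)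

  siteView : ∀ c τ → SiteView c τ (site c τ)
  siteView c τ with τ + c ≟ P
  ... | yes at-own = own-gate at-own
  siteView zero    τ | no not-own = ordinary not-own (λ ())
  siteView (suc c) τ | no not-own with τ + c ≟ P
  ...   | yes at-prev = prev-gate refl at-prev
  ...   | no not-prev = ordinary not-own (λ { refl → not-prev })

  vertex-<m : ∀ τ → vertex (stateAt τ) < m
  vertex-<m τ = ≤-trans (vertex-<2h (stateAt τ) (stateAt-valid τ)) 2h≤m

  shifted-<m : ∀ c τ → shifted c τ < m
  shifted-<m c τ = m%n<n (vertex (stateAt τ) + c) m

  shifted≢gate : ∀ c τ j → shifted c τ ≢ m + j
  shifted≢gate c τ j eq = <⇒≱ (subst (_< m) eq (shifted-<m c τ)) (m≤m+n m j)

  site-<n : ∀ c τ → c < k → site c τ < n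
  site-<n c τ c<k with site c τ | siteView c τ
  ... | _ | own-gate _       = +-monoʳ-< m c<k
  ... | _ | prev-gate refl _ = +-monoʳ-< m (≤-trans (n≤1+n _) c<k)
  ... | _ | ordinary _ _     = ≤-trans (shifted-<m c τ) (m≤m+n m k)

  ordinary-site : ∀ c τ → site c τ < m → site c τ ≡ shifted c τ
  ordinary-site c τ with site c τ | siteView c τ
  ... | _ | own-gate _       = λ gate<m → ⊥-elim (<⇒≱ gate<m (m≤m+n m c))
  ... | _ | prev-gate _ _    = λ gate<m → ⊥-elim (<⇒≱ gate<m (m≤m+n m _))
  ... | _ | ordinary _ _     = λ _ → refl

  gate-phase : ∀ c i j → m ≤ site c i → site c i ≡ site c j → i ≡ j
  gate-phase c i j with site c i | siteView c i | site c j | siteView c j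
  ... | _ | own-gate ei | _ | own-gate ej = λ _ _ → +-cancelʳ-≡ c i j (trans ei (sym ej))
  ... | _ | own-gate _ | _ | prev-gate refl _ = λ _ eq → ⊥-elim (1+n≢n (+-cancelˡ-≡ m _ _ eq))
  ... | _ | prev-gate refl _ | _ | own-gate _ = λ _ eq → ⊥-elim (1+n≢n (+-cancelˡ-≡ m _ _ (sym eq)))
  ... | _ | prev-gate refl ei | _ | prev-gate refl ej = λ _ _ → +-cancelʳ-≡ _ i j (trans ei (sym ej))
  ... | _ | ordinary _ _ | _ | _ = λ gate≤ _ → ⊥-elim (<⇒≱ (shifted-<m c i) gate≤)
  ... | _ | own-gate _ | _ | ordinary _ _ = λ _ eq → ⊥-elim (shifted≢gate c j c (sym eq))
  ... | _ | prev-gate _ _ | _ | ordinary _ _ = λ _ eq → ⊥-elim (shifted≢gate c j _ (sym eq))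

  shifted-cancel : ∀ c τ τ' → c < m → shifted c τ ≡ shifted c τ' →
                   vertex (stateAt τ) ≡ vertex (stateAt τ')
  shifted-cancel c τ τ' c<m eq = %-translate-injective c m (vertex-<m τ) (vertex-<m τ')
    (trans (cong (_% m) (+-comm c _)) (trans eq (cong (_% m) (+-comm _ c))))

  route-no-loop : ∀ c i → c < m → i ≤ P → site c i ≢ site c (tick i)
  route-no-loop c i c<m i≤P eq with m ≤? site c i
  ... | yes at-gate = %-step-moves P i P≢0 i≤P (sym (gate-phase c i (tick i) at-gate eq))
  ... | no not-gate = vertex-no-loop (stateAt i) (stateAt-valid i)
        (trans (shifted-cancel c i (tick i) c<m same-shifted) (cong vertex (stateAt-tick i i≤P)))
    where
    i<m = ≰⇒> not-gate
    same-shifted : shifted c i ≡ shifted c (tick i)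
    same-shifted = trans (sym (ordinary-site c i i<m))
                         (trans eq (ordinary-site c (tick i) (subst (_< m) eq i<m)))

  route-no-multi-edge : ∀ c i j → c < m → i ≤ P → j ≤ P →
    site c i ≡ site c j → site c (tick i) ≡ site c (tick j) → i ≡ j
  route-no-multi-edge c i j c<m i≤P j≤P eq eq' with m ≤? site c i | m ≤? site c (tick i)
  ... | yes at-gate | _ = gate-phase c i j at-gate eq
  ... | no _ | yes at-gate = tick-injective i≤P j≤P (gate-phase c (tick i) (tick j) at-gate eq')
  ... | no not-gate | no not-gate' = stateAt-injective i≤P j≤P
        (vertex-edge-injective (stateAt i) (stateAt j) (stateAt-valid i) (stateAt-valid j) same-vertex same-next)
    where
    ordinary-eq : ∀ a b → ¬ (m ≤ site c a) → site c a ≡ site c b →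
                  vertex (stateAt a) ≡ vertex (stateAt b)
    ordinary-eq a b not-gate eq = shifted-cancel c a b c<m
      (trans (sym (ordinary-site c a (≰⇒> not-gate)))
             (trans eq (ordinary-site c b (subst (_< m) eq (≰⇒> not-gate)))))
    same-vertex : vertex (stateAt i) ≡ vertex (stateAt j)
    same-vertex = ordinary-eq i j not-gate eq
    same-next : vertex (next (stateAt i)) ≡ vertex (next (stateAt j))
    same-next = trans (cong vertex (sym (stateAt-tick i i≤P)))
                      (trans (ordinary-eq (tick i) (tick j) not-gate' eq') (cong vertex (stateAt-tick j j≤P)))

  carriers-meet< : ∀ c c' τ → c < c' → c' < m → site c τ ≡ site c' τ → c' ≡ suc c × τ + c ≡ P
  carriers-meet< c c' τ c<c' c'<m with site c τ | siteView c τ | site c' τ | siteView c' τ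
  ... | _ | ordinary _ _ | _ | ordinary _ _ = λ eq →
        ⊥-elim (<⇒≢ c<c' (%-translate-injective (vertex (stateAt τ)) m (<-trans c<c' c'<m) c'<m eq))
  ... | _ | ordinary _ _ | _ | own-gate _  = λ eq → ⊥-elim (shifted≢gate c τ c' eq)
  ... | _ | ordinary _ _ | _ | prev-gate _ _ = λ eq → ⊥-elim (shifted≢gate c τ _ eq)
  ... | _ | own-gate _ | _ | ordinary _ _ = λ eq → ⊥-elim (shifted≢gate c' τ c (sym eq))
  ... | _ | prev-gate _ _ | _ | ordinary _ _ = λ eq → ⊥-elim (shifted≢gate c' τ _ (sym eq))
  ... | _ | own-gate _ | _ | own-gate _ = λ eq → ⊥-elim (<⇒≢ c<c' (+-cancelˡ-≡ m _ _ eq))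
  ... | _ | own-gate ph | _ | prev-gate refl _ = λ eq → cong suc (sym (+-cancelˡ-≡ m _ _ eq)) , ph
  ... | _ | prev-gate refl _ | _ | own-gate _ = λ eq →
        ⊥-elim (<-asym c<c' (subst (_< suc _) (+-cancelˡ-≡ m _ _ eq) (n<1+n _)))
  ... | _ | prev-gate refl _ | _ | prev-gate refl _ = λ eq →
        ⊥-elim (<⇒≢ c<c' (cong suc (+-cancelˡ-≡ m _ _ eq)))

  carriers-meet : ∀ c c' τ → c < m → c' < m → site c τ ≡ site c' τ →
    c ≡ c' ⊎ (c' ≡ suc c × τ + c ≡ P) ⊎ (c ≡ suc c' × τ + c' ≡ P)
  carriers-meet c c' τ c<m c'<m eq with <-cmp c c'
  ... | tri< c<c' _ _ = inj₂ (inj₁ (carriers-meet< c c' τ c<c' c'<m eq))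
  ... | tri≈ _ c≡c' _ = inj₁ c≡c'
  ... | tri> _ _ c>c' = inj₂ (inj₂ (carriers-meet< c' c τ c>c' c<m (sym eq)))

  routes : Fin k → Fin p → Fin n
  routes c i = fromℕ< (site-<n (toℕ c) (toℕ i) (toℕ<n c))

  G : HomPV n k
  G = record { pred-period = P ; route = routes }

  at-site : ∀ c t → toℕ (at G c t) ≡ site (toℕ c) (t % p)
  at-site c t = trans (toℕ-fromℕ< _) (cong (site (toℕ c)) (toℕ-fromℕ< (m%n<n t p)))

  carrier-<m : ∀ (c : Fin k) → toℕ c < m
  carrier-<m c = ≤-trans (toℕ<n c) k≤m

  simple : Simple G
  simple c = no-loop , no-multi-edge
    where
    at-phase : ∀ (i : Fin p) → toℕ (at G c (toℕ i)) ≡ site (toℕ c) (toℕ i)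
    at-phase i = trans (at-site c (toℕ i)) (cong (site (toℕ c)) (m<n⇒m%n≡m (toℕ<n i)))
    after-phase : ∀ (i : Fin p) → toℕ (at G c (suc (toℕ i))) ≡ site (toℕ c) (tick (toℕ i))
    after-phase i = at-site c (suc (toℕ i))
    no-loop : ∀ (i : Fin p) → at G c (toℕ i) ≢ at G c (suc (toℕ i))
    no-loop i eq = route-no-loop (toℕ c) (toℕ i) (carrier-<m c) (≤-pred (toℕ<n i))
      (trans (sym (at-phase i)) (trans (cong toℕ eq) (after-phase i)))
    no-multi-edge : ∀ (i j : Fin p) → at G c (toℕ i) ≡ at G c (toℕ j) →
                    at G c (suc (toℕ i)) ≡ at G c (suc (toℕ j)) → i ≡ j
    no-multi-edge i j eq eq' = toℕ-injective
      (route-no-multi-edge (toℕ c) (toℕ i) (toℕ j) (carrier-<m c) (≤-pred (toℕ<n i)) (≤-pred (toℕ<n j))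
        (trans (sym (at-phase i)) (trans (cong toℕ eq) (at-phase j)))
        (trans (sym (after-phase i)) (trans (cong toℕ eq') (after-phase j))))

  topGate : Fin n
  topGate = fromℕ< (+-monoʳ-< m (n<1+n k₁))

  toℕ-topGate : toℕ topGate ≡ m + k₁
  toℕ-topGate = toℕ-fromℕ< (+-monoʳ-< m (n<1+n k₁))

  at-top-gate : ∀ c τ → c < k → site c τ ≡ m + k₁ → c ≡ k₁ × τ + c ≡ P
  at-top-gate c τ c<k with site c τ | siteView c τ
  ... | _ | own-gate ph      = λ eq → +-cancelˡ-≡ m _ _ eq , ph
  ... | _ | prev-gate refl _ = λ eq → ⊥-elim (<-irrefl (cong suc (+-cancelˡ-≡ m _ _ eq)) c<k)
  ... | _ | ordinary _ _     = λ eq → ⊥-elim (shifted≢gate c τ k₁ eq)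

  Late : ℕ → Fin n → Set
  Late t y = (∀ (c : Fin k) → at G c t ≡ y → toℕ c * P ≤ t) × (y ≡ topGate → k * P ≤ t)

  -- Riding carrier c one step preserves the invariant: at time t + 1 carrier c shares its
  -- site only with itself, with c − 1, or with c + 1 at gate c; in the last case the gate
  -- phase forces  (c + 1)·P ≤ t + 1  (late-phase).  The top gate is reached the same way.
  late-step : ∀ {t y} → Late t y → (c : Fin k) → at G c t ≡ y → Late (suc t) (at G c (suc t))
  late-step {t} (present , _) c boarded = present' , top
    where
    cP≤t = present c boarded
    present' : ∀ (c' : Fin k) → at G c' (suc t) ≡ at G c (suc t) → toℕ c' * P ≤ suc t
    present' c' met with carriers-meet (toℕ c') (toℕ c) (tick t) (carrier-<m c') (carrier-<m c)
                      (trans (sym (at-site c' (suc t))) (trans (cong toℕ met) (at-site c (suc t))))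
    ... | inj₁ same = ≤-trans (subst (λ u → u * P ≤ t) (sym same) cP≤t) (n≤1+n t)
    ... | inj₂ (inj₁ (c≡c'+1 , _)) =
          ≤-trans (*-monoˡ-≤ P (subst (toℕ c' ≤_) (sym c≡c'+1) (n≤1+n _))) (≤-trans cP≤t (n≤1+n t))
    ... | inj₂ (inj₂ (c'≡c+1 , at-gate)) =
          subst (λ u → u * P ≤ suc t) (sym c'≡c+1) (late-phase P (toℕ c) t cP≤t at-gate)
    top : at G c (suc t) ≡ topGate → k * P ≤ suc t
    top arrived with at-top-gate (toℕ c) (tick t) (toℕ<n c)
                       (trans (sym (at-site c (suc t))) (trans (cong toℕ arrived) toℕ-topGate))
    ... | c≡k₁ , at-gate = subst (λ u → suc u * P ≤ suc t) c≡k₁ (late-phase P (toℕ c) t cP≤t at-gate)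

  late-run : ∀ {t y} {r : Run G t y} → Late t y → Visits topGate r → k * P ≤ t + moves r
  late-run {t} (_ , top) here = ≤-trans (top refl) (m≤m+n t _)
  late-run {t} inv (there {c = c} {e = boarded} {r = r} v) =
    subst (k * P ≤_) (sym (+-suc t (moves r))) (late-run (late-step inv c boarded) v)

  -- The hard starting site: where carrier 0 starts.
  c₀ : Fin k
  c₀ = Fin.zero

  x₀ : Fin n
  x₀ = at G c₀ 0

  -- At time 0 only carrier 0 is at x₀, which is not the top gate.
  late-start : Late 0 x₀
  late-start = present , top
    where
    site-at-0 : ∀ c → toℕ (at G c 0) ≡ site (toℕ c) 0
    site-at-0 c = trans (at-site c 0) (cong (site (toℕ c)) (m<n⇒m%n≡m {n = p} (s≤s z≤n)))
    present : ∀ (c : Fin k) → at G c 0 ≡ x₀ → toℕ c * P ≤ 0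
    present c eq with carriers-meet (toℕ c) 0 0 (carrier-<m c) (carrier-<m c₀)
                        (trans (sym (site-at-0 c)) (trans (cong toℕ eq) (site-at-0 c₀)))
    ... | inj₁ c≡0 = subst (λ u → u * P ≤ 0) (sym c≡0) z≤n
    ... | inj₂ (inj₁ (() , _))
    ... | inj₂ (inj₂ (_ , P≡0)) = ⊥-elim (P≢0 (sym P≡0))
    top : x₀ ≡ topGate → k * P ≤ 0
    top eq = ⊥-elim (P≢0 (sym (proj₂ (at-top-gate 0 0 (s≤s z≤n)
               (trans (sym (site-at-0 c₀)) (trans (cong toℕ eq) toℕ-topGate))))))

  exploration-is-long : ∀ (σ : Strategy G) → k * P ≤ moves (proj₁ (σ x₀ (c₀ , refl)))
  exploration-is-long σ = late-run late-start (proj₂ (σ x₀ (c₀ , refl)) topGate)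

  -- Feasibility needs room in the cycle:  2h < P  (so also  k ≤ P).
  2h<P : h + h < P
  2h<P = ≤-trans (m≤m+n (suc (h + h)) 2) (subst (_≤ P) (sym (unfold h₁)) P-grows)
    where
    P-grows : 2 * (1 * h + 1) + 1 ≤ P
    P-grows = +-monoˡ-≤ 1 (*-monoʳ-≤ 2 (+-mono-≤ (*-monoˡ-≤ h 1≤h₁) 1≤h₁))
    unfold : ∀ h₁ → suc (suc h₁ + suc h₁) + 2 ≡ 2 * (1 * suc h₁ + 1) + 1
    unfold = solve-∀

  k≤P : k ≤ P
  k≤P = ≤-trans k≤m (≤-trans m≤2h+1 2h<P)

  site-own-gate : ∀ c τ → τ + c ≡ P → site c τ ≡ m + c
  site-own-gate c τ ph with site c τ | siteView c τ
  ... | _ | own-gate _         = refl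
  ... | _ | prev-gate refl ph' = ⊥-elim (1+n≢n (+-cancelˡ-≡ τ _ _ (trans ph (sym ph'))))
  ... | _ | ordinary not-own _ = ⊥-elim (not-own ph)

  site-prev-gate : ∀ c τ → τ + c ≡ P → site (suc c) τ ≡ m + c
  site-prev-gate c τ ph with site (suc c) τ | siteView (suc c) τ
  ... | _ | own-gate ph'        = ⊥-elim (1+n≢n (+-cancelˡ-≡ τ _ _ (trans ph' (sym ph))))
  ... | _ | prev-gate refl _    = refl
  ... | _ | ordinary _ not-prev = ⊥-elim (not-prev refl ph)

  site-ordinary : ∀ c τ → τ + c < P → site c τ ≡ shifted c τ
  site-ordinary c τ before with site c τ | siteView c τ
  ... | _ | own-gate ph        = ⊥-elim (<-irrefl ph before)
  ... | _ | prev-gate refl ph  = ⊥-elim (<-irrefl ph (≤-<-trans (+-monoʳ-≤ τ (n≤1+n _)) before))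
  ... | _ | ordinary _ _       = refl

  carrier : ∀ j → j < k → Fin k
  carrier j j<k = fromℕ< j<k

  gate : ∀ j → j < k → Fin n
  gate j j<k = fromℕ< (+-monoʳ-< m j<k)

  at-carrier : ∀ j (j<k : j < k) t → toℕ (at G (carrier j j<k) t) ≡ site j (t % p)
  at-carrier j j<k t = trans (at-site (carrier j j<k) t) (cong (λ c → site c (t % p)) (toℕ-fromℕ< j<k))

  at-own-gate : ∀ j (j<k : j < k) t → t % p + j ≡ P → at G (carrier j j<k) t ≡ gate j j<k
  at-own-gate j j<k t ph = toℕ-injective
    (trans (at-carrier j j<k t) (trans (site-own-gate j _ ph) (sym (toℕ-fromℕ< (+-monoʳ-< m j<k)))))

  at-prev-gate : ∀ j (j<k : j < k) (j+1<k : suc j < k) t → t % p + j ≡ P →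
                 at G (carrier (suc j) j+1<k) t ≡ gate j j<k
  at-prev-gate j j<k j+1<k t ph = toℕ-injective
    (trans (at-carrier (suc j) j+1<k t) (trans (site-prev-gate j _ ph) (sym (toℕ-fromℕ< (+-monoʳ-< m j<k)))))

  phase-forward : ∀ t j → t % p + suc j ≡ P → suc t % p + j ≡ P
  phase-forward t j ph = trans (cong (_+ j) (%-step P t τ<P)) (trans (sym (+-suc (t % p) j)) ph)
    where
    τ<P : t % p < P
    τ<P = subst (t % p <_) ph (m<m+n (t % p) (s≤s z≤n))

  phase-back : ∀ t j → j < P → t % p + j ≡ P → (P + t) % p + suc j ≡ P
  phase-back t j j<P ph with t % p in phase
  ... | zero  = ⊥-elim (<-irrefl ph j<P)
  ... | suc τ = trans (cong (_+ suc j) (%-step-back P t τ phase)) (trans (+-suc τ j) ph)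

  open Runs G

  descend : ∀ j t T (j<k : j < k) → j + t ≡ T → t % p + j ≡ P →
            Run G T (at G c₀ T) → Run G t (at G (carrier j j<k) t)
  descend zero    t T j<k   refl _  r = r
  descend (suc j) t T j+1<k eq   ph r =
    move (carrier (suc j) j+1<k) refl (transfer meet (descend j (suc t) T j<k (trans (+-suc j t) eq) ph' r))
    where
    j<k  = <-trans (n<1+n j) j+1<k
    ph'  = phase-forward t j ph
    meet : at G (carrier j j<k) (suc t) ≡ at G (carrier (suc j) j+1<k) (suc t)
    meet = trans (at-own-gate j j<k (suc t) ph') (sym (at-prev-gate j j<k j+1<k (suc t) ph'))

  descend-keeps : ∀ {s} j t T j<k eq ph r → Visits s r → Visits s (descend j t T j<k eq ph r)
  descend-keeps zero    t T _ refl _ r v = v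
  descend-keeps (suc j) t T _ _    _ r v = there (transfer-keeps _ _ (descend-keeps j (suc t) T _ _ _ r v))

  -- From carrier j at gate j, climb to the top gate: board carrier j + 1 there and
  -- ride it for P steps to gate j + 1, and so on (d more gates to go).
  climb : ∀ d j t (j<k : j < k) → d + j ≡ k₁ → t % p + j ≡ P → Run G t (at G (carrier j j<k) t)
  climb zero    j t j<k _  _  = halt
  climb (suc d) j t j<k eq ph =
    transfer meet (ride (carrier (suc j) j+1<k) P t (P + t) refl
                        (climb d (suc j) (P + t) j+1<k (trans (+-suc d j) eq) ph'))
    where
    j<k₁ : j < k₁
    j<k₁ = subst (j <_) eq (s≤s (m≤n+m j d))
    j+1<k = s≤s j<k₁
    ph' = phase-back t j (<-≤-trans j<k₁ (≤-trans (n≤1+n k₁) k≤P)) ph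
    meet : at G (carrier (suc j) j+1<k) t ≡ at G (carrier j j<k) t
    meet = trans (at-prev-gate j j<k j+1<k t ph) (sym (at-own-gate j j<k t ph))

  climb-visits-gates : ∀ d j t j<k eq ph i (i<k : i < k) → j ≤ i → Visits (gate i i<k) (climb d j t j<k eq ph)
  climb-visits-gates d j t j<k eq ph i i<k j≤i with m≤n⇒m<n∨m≡n j≤i
  ... | inj₂ refl = subst (λ y → Visits y (climb d j t j<k eq ph)) (at-own-gate j j<k t ph) here
  climb-visits-gates zero j t j<k eq ph i i<k j≤i | inj₁ j<i =
    ⊥-elim (<⇒≱ i<k (subst (_≤ i) (cong suc eq) j<i))
  climb-visits-gates (suc d) j t j<k eq ph i i<k j≤i | inj₁ j<i =
    transfer-keeps _ _ (ride-keeps _ P t (P + t) refl _ (climb-visits-gates d (suc j) (P + t) _ _ _ i i<k j<i))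

  climb-first-leg : ∀ d j t j<k eq ph (j+1<k : suc j < k) i → 1 ≤ d → i ≤ P →
    Visits (at G (carrier (suc j) j+1<k) (i + t)) (climb d j t j<k eq ph)
  climb-first-leg (suc d) j t j<k eq ph j+1<k i _ i≤P =
    transfer-keeps _ _ (ride-visits _ P t (P + t) refl _ i i≤P)

  phase-after-P : ∀ τ → τ ≤ P → (suc τ + P) % p ≡ τ
  phase-after-P τ τ≤P = begin
    (suc τ + P) % p  ≡⟨ cong (_% p) (+-suc τ P) ⟨
    (τ + p) % p      ≡⟨ [m+n]%n≡m%n τ p ⟩
    τ % p            ≡⟨ m<n⇒m%n≡m (s≤s τ≤P) ⟩
    τ                ∎
    where open ≡-Reasoning

  phase-after-p+P : ∀ τ → τ ≤ P → (suc τ + (p + P)) % p ≡ τ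
  phase-after-p+P τ τ≤P = begin
    (suc τ + (p + P)) % p  ≡⟨ cong (_% p) (regroup (suc τ) p P) ⟩
    (suc τ + P + p) % p    ≡⟨ [m+n]%n≡m%n (suc τ + P) p ⟩
    (suc τ + P) % p        ≡⟨ phase-after-P τ τ≤P ⟩
    τ                      ∎
    where
    open ≡-Reasoning
    regroup : ∀ a p P → a + (p + P) ≡ a + P + p
    regroup = solve-∀

  module Exploration (c : Fin k) where
    j : ℕ
    j = toℕ c

    j≤P : j ≤ P
    j≤P = ≤-trans (<⇒≤ (toℕ<n c)) k≤P

    climbing : Run G (p + P) (at G c₀ (p + P))
    climbing = climb k₁ 0 (p + P) (s≤s z≤n) (+-identityʳ k₁) at-gate-0
      where
      at-gate-0 : (p + P) % p + 0 ≡ P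
      at-gate-0 = begin
        (p + P) % p + 0  ≡⟨ +-identityʳ _ ⟩
        (p + P) % p      ≡⟨ cong (_% p) (+-comm p P) ⟩
        (P + p) % p      ≡⟨ [m+n]%n≡m%n P p ⟩
        P % p            ≡⟨ m<n⇒m%n≡m (n<1+n P) ⟩
        P                ∎
        where open ≡-Reasoning

    circling : Run G P (at G c₀ P)
    circling = ride c₀ p P (p + P) refl climbing

    descending : Run G (P ∸ j) (at G (carrier j (toℕ<n c)) (P ∸ j))
    descending = descend j (P ∸ j) P (toℕ<n c) (m+[n∸m]≡n j≤P)
      (trans (cong (_+ j) (m<n⇒m%n≡m (s≤s (m∸n≤m P j)))) (m∸n+n≡m j≤P)) circling

    exploring : Run G 0 (at G c 0)
    exploring = ride c (P ∸ j) 0 (P ∸ j) (+-identityʳ _)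
      (transfer (cong (λ c' → at G c' (P ∸ j)) (fromℕ<-toℕ c (toℕ<n c))) descending)

    keeps-circling : ∀ {s} → Visits s circling → Visits s exploring
    keeps-circling v =
      ride-keeps c (P ∸ j) 0 (P ∸ j) _ _ (transfer-keeps _ _ (descend-keeps j (P ∸ j) P _ _ _ circling v))

    keeps-climbing : ∀ {s} → Visits s climbing → Visits s exploring
    keeps-climbing v = keeps-circling (ride-keeps c₀ p P (p + P) refl climbing v)

    visits-gates : ∀ s → m ≤ toℕ s → Visits s exploring
    visits-gates s m≤s = keeps-climbing (subst (λ y → Visits y climbing) is-gate
                           (climb-visits-gates k₁ 0 (p + P) _ _ _ i i<k z≤n))
      where
      i = toℕ s ∸ m
      m+i≡s : m + i ≡ toℕ s
      m+i≡s = m+[n∸m]≡n m≤s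
      i<k : i < k
      i<k = +-cancelˡ-< m i k (subst (_< n) (sym m+i≡s) (toℕ<n s))
      is-gate : gate i i<k ≡ s
      is-gate = toℕ-injective (trans (toℕ-fromℕ< (+-monoʳ-< m i<k)) m+i≡s)

    visits-tour : ∀ s → toℕ s < h + h → Visits s exploring
    visits-tour s s<2h = keeps-circling (subst (λ y → Visits y circling) on-s
                           (ride-visits c₀ p P (p + P) refl climbing (suc τ) (s≤s τ≤P)))
      where
      open ≡-Reasoning
      τ = proj₁ (round0-covers (toℕ s) s<2h)
      τ<2h = proj₁ (proj₂ (round0-covers (toℕ s) s<2h))
      τ-on-s = proj₂ (proj₂ (round0-covers (toℕ s) s<2h))
      τ≤P : τ ≤ P
      τ≤P = <⇒≤ (<-trans τ<2h 2h<P)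
      τ+0<P : τ + 0 < P
      τ+0<P = subst (_< P) (sym (+-identityʳ τ)) (<-trans τ<2h 2h<P)
      on-s : at G c₀ (suc τ + P) ≡ s
      on-s = toℕ-injective (begin
        toℕ (at G c₀ (suc τ + P))       ≡⟨ at-site c₀ (suc τ + P) ⟩
        site 0 ((suc τ + P) % p)        ≡⟨ cong (site 0) (phase-after-P τ τ≤P) ⟩
        site 0 τ                        ≡⟨ site-ordinary 0 τ τ+0<P ⟩
        (vertex (stateAt τ) + 0) % m    ≡⟨ cong (λ v → (v + 0) % m) τ-on-s ⟩
        (toℕ s + 0) % m                 ≡⟨ cong (_% m) (+-identityʳ (toℕ s)) ⟩
        toℕ s % m                       ≡⟨ m<n⇒m%n≡m (<-≤-trans s<2h 2h≤m) ⟩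
        toℕ s                           ∎)

    -- When m = 2h + 1, the site 2h is passed by carrier 1 on the first leg of the climb.
    visits-last-column : ∀ s → toℕ s < m → toℕ s ≡ h + h → Visits s exploring
    visits-last-column s s<m s≡2h = keeps-climbing (subst (λ y → Visits y climbing) on-s
                                  (climb-first-leg k₁ 0 (p + P) _ _ _ 1<k (h + h) 1≤k₁ (<⇒≤ 2h<P)))
      where
      open ≡-Reasoning
      1<k : 1 < k
      1<k = s≤s 1≤k₁
      τ = suc (2 * h₁)
      2h≡τ+1 : h + h ≡ suc τ
      2h≡τ+1 = double h₁
        where
        double : ∀ h₁ → suc h₁ + suc h₁ ≡ suc (suc (2 * h₁))
        double = solve-∀
      τ+1<P : τ + 1 < P
      τ+1<P = subst (_< P) (trans 2h≡τ+1 (+-comm 1 τ)) 2h<P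
      τ≤P : τ ≤ P
      τ≤P = <⇒≤ (≤-<-trans (m≤m+n τ 1) τ+1<P)
      h+h₁+1≡2h : h + h₁ + 1 ≡ h + h
      h+h₁+1≡2h = trans (+-assoc h h₁ 1) (cong (λ u → h + u) (+-comm h₁ 1))
      on-s : at G (carrier 1 1<k) (h + h + (p + P)) ≡ s
      on-s = toℕ-injective (begin
        toℕ (at G (carrier 1 1<k) (h + h + (p + P)))  ≡⟨ at-carrier 1 1<k (h + h + (p + P)) ⟩
        site 1 ((h + h + (p + P)) % p)  ≡⟨ cong (λ t → site 1 ((t + (p + P)) % p)) 2h≡τ+1 ⟩
        site 1 ((suc τ + (p + P)) % p)  ≡⟨ cong (site 1) (phase-after-p+P τ τ≤P) ⟩
        site 1 τ                        ≡⟨ site-ordinary 1 τ τ+1<P ⟩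
        (vertex (stateAt τ) + 1) % m    ≡⟨ cong (λ v → (v + 1) % m) round0-last ⟩
        (h + h₁ + 1) % m                ≡⟨ cong (_% m) h+h₁+1≡2h ⟩
        (h + h) % m                     ≡⟨ cong (_% m) (sym s≡2h) ⟩
        toℕ s % m                       ≡⟨ m<n⇒m%n≡m s<m ⟩
        toℕ s                           ∎)

    explores : ∀ s → Visits s exploring
    explores s with m ≤? toℕ s | toℕ s <? h + h
    ... | yes m≤s | _        = visits-gates s m≤s
    ... | no _    | yes s<2h = visits-tour s s<2h
    ... | no s≱m  | no s≮2h  = visits-last-column s (≰⇒> s≱m)
          (≤-antisym (≤-pred (≤-trans (≰⇒> s≱m) m≤2h+1)) (≮⇒≥ s≮2h))

  feasible : Feasible G
  feasible x (c , start) = transfer start exploring , λ s → transfer-keeps start exploring (explores s)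
    where open Exploration c

Bound : ℕ → ℕ → ℕ → Set
Bound n k moves = ((+ k) ℤ.* (+ n) ℤ.* ((+ n) ℤ.- (+ 8))) ℤ.< (+ 8) ℤ.* (+ moves)

Witness : ℕ → ℕ → Set
Witness n k = Σ (HomPV n k) λ G → Simple G × Feasible G × MExceeds G (Bound n k)

-- For 4 ≤ n < 8 the bound is negative, so it holds for any number of moves.
negative-bound : ∀ r k moves → r < 4 → Bound (4 + r) (suc k) moves
negative-bound 0 k moves _ = subst (_ ℤ.<_) (ℤ.pos-* 8 moves) -<+
negative-bound 1 k moves _ = subst (_ ℤ.<_) (ℤ.pos-* 8 moves) -<+
negative-bound 2 k moves _ = subst (_ ℤ.<_) (ℤ.pos-* 8 moves) -<+
negative-bound 3 k moves _ = subst (_ ℤ.<_) (ℤ.pos-* 8 moves) -<+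
negative-bound (suc (suc (suc (suc _)))) k moves (s≤s (s≤s (s≤s (s≤s ()))))

module Cycle (n₂ k : ℕ) where
  n : ℕ
  n = suc (suc n₂)

  cycle : HomPV n k
  cycle = record { pred-period = suc n₂ ; route = λ _ i → i }

  open Runs cycle

  at-cycle : ∀ c t → toℕ (at cycle c t) ≡ t % n
  at-cycle c t = toℕ-fromℕ< (m%n<n t n)

  at-phase : ∀ c (i : Fin n) → toℕ (at cycle c (toℕ i)) ≡ toℕ i
  at-phase c i = trans (at-cycle c (toℕ i)) (m<n⇒m%n≡m (toℕ<n i))

  simple : Simple cycle
  simple c = no-loop , no-multi-edge
    where
    no-loop : ∀ (i : Fin n) → at cycle c (toℕ i) ≢ at cycle c (suc (toℕ i))
    no-loop i eq = %-step-moves (suc n₂) (toℕ i) (λ ()) (≤-pred (toℕ<n i))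
      (trans (sym (at-cycle c (suc (toℕ i)))) (trans (cong toℕ (sym eq)) (at-phase c i)))
    no-multi-edge : ∀ (i j : Fin n) → at cycle c (toℕ i) ≡ at cycle c (toℕ j) →
                    at cycle c (suc (toℕ i)) ≡ at cycle c (suc (toℕ j)) → i ≡ j
    no-multi-edge i j eq _ = toℕ-injective (trans (sym (at-phase c i)) (trans (cong toℕ eq) (at-phase c j)))

  feasible : Feasible cycle
  feasible x (c , start) = transfer start tour , λ s → transfer-keeps start tour (visits s)
    where
    tour : Run cycle 0 (at cycle c 0)
    tour = ride c (suc n₂) 0 (suc n₂) (+-identityʳ _) halt
    visits : ∀ s → Visits s tour
    visits s = subst (λ y → Visits y tour) on-s
                     (ride-visits c (suc n₂) 0 (suc n₂) _ halt (toℕ s) (≤-pred (toℕ<n s)))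
      where
      on-s : at cycle c (toℕ s + 0) ≡ s
      on-s = toℕ-injective (trans (at-cycle c (toℕ s + 0))
                                  (trans (cong (_% n) (+-identityʳ (toℕ s))) (m<n⇒m%n≡m (toℕ<n s))))

small-case : ∀ r k → r < 4 → Witness (4 + r) (suc k)
small-case r k r<4 = cycle , simple , feasible ,
  λ σ → start , (Fin.zero , refl) , negative-bound r k (moves (proj₁ (σ start (Fin.zero , refl)))) r<4
  where
  open Cycle (suc (suc r)) (suc k)
  start = at cycle Fin.zero 0

-- Numerical heart of the bound: for h = g + 2 and N ≤ 4h + 2,  N (N ∸ 8) < 8P = 16h² − 8.
square-bound : ∀ g N → N ≤ 4 * suc (suc g) + 2 → N * (N ∸ 8) < 8 * BipartiteTour.P (suc g)
square-bound g N N≤4h+2 = begin-strict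
  N * (N ∸ 8)                       ≤⟨ *-mono-≤ N≤4h+2 (∸-monoˡ-≤ 8 N≤4h+2) ⟩
  H * (H ∸ 8)                       ≡⟨ cong (λ u → u * (u ∸ 8)) (split g) ⟩
  (8 + a) * a                       <⟨ n<1+n _ ⟩
  suc ((8 + a) * a)                 ≤⟨ m≤m+n _ _ ⟩
  suc ((8 + a) * a) + (16 * g + 35) ≡⟨ expand g ⟨
  8 * BipartiteTour.P (suc g)       ∎
  where
  open ≤-Reasoning
  H = 4 * suc (suc g) + 2
  a = 4 * g + 2
  split : ∀ g → 4 * suc (suc g) + 2 ≡ 8 + (4 * g + 2)
  split = solve-∀
  expand : ∀ g → 8 * (2 * (suc g * suc (suc g) + suc g) + 1)
                 ≡ suc ((8 + (4 * g + 2)) * (4 * g + 2)) + (16 * g + 35)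
  expand = solve-∀

integer-bound : ∀ k N M → 8 ≤ N → k * (N * (N ∸ 8)) < 8 * M → Bound N k M
integer-bound k N M 8≤N lt =
  subst₂ ℤ._<_ lhs rhs (+<+ (subst (_< 8 * M) (sym (*-assoc k N (N ∸ 8))) lt))
  where
  lhs : + (k * N * (N ∸ 8)) ≡ (+ k) ℤ.* (+ N) ℤ.* ((+ N) ℤ.- (+ 8))
  lhs = trans (ℤ.pos-* (k * N) (N ∸ 8))
              (cong₂ ℤ._*_ (ℤ.pos-* k N) (sym (trans (ℤ.[+m]-[+n]≡m⊖n N 8) (ℤ.⊖-≥ 8≤N))))
  rhs : + (8 * M) ≡ (+ 8) ℤ.* (+ M)
  rhs = ℤ.pos-* 8 M

construction-witness : ∀ g k₁ m₁ → let h = suc (suc g) ; m = suc m₁ ; k = suc k₁ in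
  h + h ≤ m → m ≤ suc (h + h) → k ≤ m → 1 ≤ k₁ → 8 ≤ m + k → Witness (m + k) k
construction-witness g k₁ m₁ 2h≤m m≤2h+1 k≤m 1≤k₁ 8≤n =
  G , simple , feasible , λ σ → x₀ , (c₀ , refl) ,
    integer-bound k n (moves (proj₁ (σ x₀ (c₀ , refl)))) 8≤n
      (<-≤-trans (*-monoʳ-< k (square-bound g n n≤4h+2)) (long-run σ))
  where
  open Construction (suc g) k₁ m₁ 2h≤m m≤2h+1 k≤m (s≤s z≤n) 1≤k₁
  n≤4h+2 : n ≤ 4 * h + 2
  n≤4h+2 = ≤-trans (+-monoʳ-≤ m k≤m) (subst (m + m ≤_) (double h) (+-mono-≤ m≤2h+1 m≤2h+1))
    where
    double : ∀ h → suc (h + h) + suc (h + h) ≡ 4 * h + 2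
    double = solve-∀
  long-run : ∀ σ → k * (8 * P) ≤ 8 * moves (proj₁ (σ x₀ (c₀ , refl)))
  long-run σ = subst (_≤ 8 * moves (proj₁ (σ x₀ (c₀ , refl)))) (swap k P)
                     (*-monoʳ-≤ 8 (exploration-is-long σ))
    where
    swap : ∀ k P → 8 * (k * P) ≡ k * (8 * P)
    swap = solve-∀

halving : ∀ m → Σ ℕ λ h → h + h ≤ m × m ≤ suc (h + h)
halving zero          = 0 , z≤n , z≤n
halving (suc zero)    = 0 , z≤n , s≤s z≤n
halving (suc (suc m)) with halving m
... | h , lo , hi = suc h , s≤s (subst (_≤ suc m) (sym (+-suc h h)) (s≤s lo))
                          , s≤s (s≤s (subst (m ≤_) (sym (+-suc h h)) hi))

split-witness : ∀ m k₁ → suc k₁ ≤ m → 1 ≤ k₁ → 8 ≤ m + suc k₁ → Witness (m + suc k₁) (suc k₁)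
split-witness (suc m₁) k₁ k≤m 1≤k₁ 8≤n with halving (suc m₁)
... | suc (suc g) , 2h≤m , m≤2h+1 = construction-witness g k₁ m₁ 2h≤m m≤2h+1 k≤m 1≤k₁ 8≤n
... | 0 , _ , m≤1 = ⊥-elim (too-few (≤-trans 8≤n (+-mono-≤ m≤1 (≤-trans k≤m m≤1))))
  where
  too-few : ¬ (8 ≤ 2)
  too-few (s≤s (s≤s ()))
... | 1 , _ , m≤3 = ⊥-elim (too-few (≤-trans 8≤n (+-mono-≤ m≤3 (≤-trans k≤m m≤3))))
  where
  too-few : ¬ (8 ≤ 6)
  too-few (s≤s (s≤s (s≤s (s≤s (s≤s (s≤s ()))))))

large-case : ∀ n k₁ → 8 ≤ n → 1 ≤ k₁ → 2 * suc k₁ ≤ n → Witness n (suc k₁)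
large-case n k₁ 8≤n 1≤k₁ 2k≤n =
  subst (λ N → Witness N k) m+k≡n (split-witness m k₁ k≤m 1≤k₁ (subst (8 ≤_) (sym m+k≡n) 8≤n))
  where
  k = suc k₁
  m = n ∸ k
  k+k≤n : k + k ≤ n
  k+k≤n = subst (_≤ n) (cong (λ u → k + u) (+-identityʳ k)) 2k≤n
  m+k≡n : m + k ≡ n
  m+k≡n = m∸n+n≡m (≤-trans (m≤m+n k k) k+k≤n)
  k≤m : k ≤ m
  k≤m = +-cancelʳ-≤ k k m (subst (k + k ≤_) (sym m+k≡n) k+k≤n)

theorem5 : ∀ (n k : ℕ) → 4 ≤ n → 2 ≤ k → 2 * k ≤ n →
    Σ (HomPV n k) λ G → Simple G × Feasible G ×
      MExceeds G (λ m → ((+ k) ℤ.* (+ n) ℤ.* ((+ n) ℤ.- (+ 8))) ℤ.< (+ 8) ℤ.* (+ m))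
theorem5 (suc (suc (suc (suc r)))) (suc k₁) (s≤s (s≤s (s≤s (s≤s z≤n)))) (s≤s 1≤k₁) 2k≤n with r <? 4
... | yes r<4 = small-case r k₁ r<4
... | no r≮4  = large-case (4 + r) k₁ (+-monoʳ-≤ 4 (≮⇒≥ r≮4)) 1≤k₁ 2k≤n
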